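{- Let $\Gamma$ be a locally semicomplete commutative weakly distance-regular digraph with $3\in T$, and suppose $(1,2)$ is pure. Suppose that $4\notin T$ or $(1,3)$ is pure. Then $F_3\subseteq\{\Gamma_{0,0},\Gamma_{1,1},\Gamma_{1,2},\Gamma_{2,1},\Gamma_{2,2}\}$. Moreover, if $\Gamma_{2,2}\in F_3$, then $\Gamma_{2,2}\in\Gamma_{1,2}^2$.
   Context: Digraphs are finite with arcs being ordered pairs of distinct vertices; $N^\pm(x)$ out-/in-neighbourhoods; circuits of length $r$ are paths $(w_0,\dots,w_{r-1})$ with $(w_{r-1},w_0)$ an arc; $\partial$ distance, $\tilde\partial(x,y)=(\partial(x,y),\partial(y,x))$, $\tilde\partial(\Gamma)$ its value set. Weakly distance-regular: strongly connected and the number $p^{\tilde h}_{\tilde i,\tilde j}$ of $z$ with $\tilde\partial(x,z)=\tilde i$, $\tilde\partial(z,y)=\tilde j$ depends only on $\tilde h=\tilde\partial(x,y)$; commutative: $p^{\tilde h}_{\tilde i,\tilde j}=p^{\tilde h}_{\tilde j,\tilde i}$. Locally semicomplete: each $N^+(x)$, $N^-(x)$ induces a digraph in which any two distinct vertices are joined by at least one arc. $\Gamma_{a,b}$ is the set of pairs with two-way distance $(a,b)$; $(a,b)^t=(b,a)$. An arc $(x,y)$ has type $(1,r)$ if $\partial(y,x)=r$; $T=\{q:(1,q-1)\in\tilde\partial(\Gamma)\}$. For $q\in T$, $(1,q-1)$ is pure if every circuit of length $q$ containing an arc of type $(1,q-1)$ consists of arcs of type $(1,q-1)$. For nonempty sets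 $E,F$ of relations $EF=\{\Gamma_{\tilde h}:\sum_E\sum_F p^{\tilde h}_{\tilde i,\tilde j}\neq0\}$, $\Gamma_{\tilde i}^2=\{\Gamma_{\tilde i}\}\{\Gamma_{\tilde i}\}$; $F$ is closed if $\{\Gamma_{\tilde i^t}\}\{\Gamma_{\tilde j}\}\subseteq F$ for all $\Gamma_{\tilde i},\Gamma_{\tilde j}\in F$; $F_3$ is the smallest closed set containing $\Gamma_{1,2}$. -}

module Defs where

open import Data.Nat using (ℕ; zero; suc; _<_)
open import Data.Nat.Properties using () renaming (_≟_ to _≟ℕ_)
open import Data.Bool using (Bool; true; false; _∧_; if_then_else_)
open import Data.Fin using (Fin; zero; suc; inject₁; fromℕ; _≟_)
open import Data.List using (List; filter; length)
open import Data.Bool.ListAction using (any)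
open import Data.List.Base using (allFin)
open import Data.Product using (_×_; _,_; ∃; ∃-syntax; swap)
open import Data.Product.Properties using (≡-dec)
open import Data.Sum using (_⊎_)
open import Relation.Nullary using (¬_; does)
open import Relation.Nullary.Decidable using (_×-dec_)
open import Relation.Binary.PropositionalEquality using (_≡_; _≢_)
open import Level using (Level) renaming (suc to lsuc)

record Digraph : Set where
  field
    n     : ℕ
    arc   : Fin n → Fin n → Bool
    irrefl : ∀ x → arc x x ≡ false

module _ (G : Digraph) where
  open Digraph G

  V : Set
  V = Fin n

  Arc : V → V → Set
  Arc x y = arc x y ≡ true

  walkB : ℕ → V → V → Bool
  walkB zero    x y = does (x ≟ y)
  walkB (suc k) x y = any (λ z → arc x z ∧ walkB k z y) (allFin n)

  search : ℕ → ℕ → V → V → ℕ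
  search zero       k x y = k
  search (suc fuel) k x y = if walkB k x y then k else search fuel (suc k) x y

  -- ∂(x,y): the length of a shortest walk (= shortest path) from x to y.
  -- (A shortest walk, when it exists, has length < n; for strongly connected
  -- digraphs this is the usual distance.)
  dist : V → V → ℕ
  dist x y = search n 0 x y

  StronglyConnected : Set
  StronglyConnected = ∀ x y → ∃[ k ] walkB k x y ≡ true

  Rel : Set
  Rel = ℕ × ℕ

  dist2 : V → V → Rel
  dist2 x y = (dist x y , dist y x)

  InValues : Rel → Set
  InValues h = ∃[ x ] ∃[ y ] dist2 x y ≡ h

  pcount : V → V → Rel → Rel → ℕ
  pcount x y i j =
    length (filter (λ z → ≡-dec _≟ℕ_ _≟ℕ_ (dist2 x z) i ×-dec ≡-dec _≟ℕ_ _≟ℕ_ (dist2 z y) j) (allFin n))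

  WeaklyDistanceRegular : Set
  WeaklyDistanceRegular =
    StronglyConnected ×
    (∀ x y x' y' i j → dist2 x y ≡ dist2 x' y' → pcount x y i j ≡ pcount x' y' i j)

  Commutative : Set
  Commutative = ∀ x y i j → pcount x y i j ≡ pcount x y j i

  LocallySemicomplete : Set
  LocallySemicomplete =
    (∀ x y z → Arc x y → Arc x z → y ≢ z → Arc y z ⊎ Arc z y) ×
    (∀ x y z → Arc y x → Arc z x → y ≢ z → Arc y z ⊎ Arc z y)

  -- q ∈ T  iff  (1, q-1) ∈ ∂̃(Γ); we state it with r = q - 1
  InT-pred : ℕ → Set
  InT-pred r = InValues (1 , r)

  -- A circuit of length suc m: a path (w₀,…,w_m) (distinct vertices,
  -- consecutive arcs) together with the closing arc (w_m , w₀).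
  IsCircuit : (m : ℕ) → (Fin (suc m) → V) → Set
  IsCircuit m w =
    (∀ i j → w i ≡ w j → i ≡ j) ×
    (∀ (i : Fin m) → Arc (w (inject₁ i)) (w (suc i))) ×
    Arc (w (fromℕ m)) (w zero)

  CircuitArc : (m : ℕ) → (Fin (suc m) → V) → V → V → Set
  CircuitArc m w x y =
    (∃[ i ] (x ≡ w (inject₁ i) × y ≡ w (suc i))) ⊎ (x ≡ w (fromℕ m) × y ≡ w zero)

  HasType : ℕ → V → V → Set
  HasType r x y = Arc x y × dist y x ≡ r

  Pure : ℕ → Set
  Pure m = ∀ (w : Fin (suc m) → V) → IsCircuit m w →
    (∃[ x ] ∃[ y ] (CircuitArc m w x y × HasType m x y)) →
    ∀ x y → CircuitArc m w x y → HasType m x y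

  Prod : Rel → Rel → Rel → Set
  Prod i j h = ∃[ x ] ∃[ y ] (dist2 x y ≡ h × pcount x y i j ≢ 0)

  Closed : (Rel → Set) → Set
  Closed F = ∀ i j h → F i → F j → Prod (swap i) j h → F h

  InF3 : Rel → Set₁
  InF3 h = ∀ (F : Rel → Set) → (∀ h' → F h' → InValues h') → Closed F → F (1 , 2) → F h

{-# OPTIONS --safe #-}
-- Purity of (1,2) puts every (1,2)-arc on a triangle of (1,2)-arcs, so the
-- relation C generated by the (1,2)-arcs is symmetric.  Purity of (1,3), or
-- 4 ∉ T, forbids a 4-circuit containing arcs of both types (1,3) and (1,2);
-- with local semicompleteness this shows that appending a (1,2)-arc to a pair
-- lying in Γ₀₀, Γ₁₁, Γ₁₂, Γ₂₁, or in Γ₂₂ and joined by a path of two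
-- (1,2)-arcs, yields again such a pair.  By weak distance-regularity the
-- relations all of whose pairs lie in C form a closed set containing Γ₁₂,
-- hence every relation in F₃ consists of such pairs.
module Submission where

open import Defs
open import Data.Bool using (true; false; T; _∧_)
import Data.Bool as Bool
open import Data.Bool.Properties using (T-≡; T-∧)
open import Data.Empty using (⊥; ⊥-elim)
open import Data.Fin using (Fin; zero; suc; _≟_)
open import Data.Fin.Properties using (nonZeroIndex)
open import Data.List using (List; []; _∷_; length; filter; allFin)
open import Level using (0ℓ)
open import Relation.Unary using (Pred; Decidable)
open import Data.List.Relation.Unary.Any using (here; there; satisfied)
open import Data.List.Relation.Unary.Any.Properties using (any⁺; any⁻)
open import Data.List.Membership.Propositional using (_∈_; lose)
open import Data.List.Membership.Propositional.Properties
  using (∈-allFin; ∈-filter⁺; ∈-filter⁻)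
open import Data.Nat using (ℕ; zero; suc; _+_; _≤_; _<_; z≤n; s≤s; >-nonZero⁻¹)
open import Data.Nat.Properties
  using (≤-antisym; ≤-pred; ≤∧≢⇒<; ≤-<-trans; m≤n⇒m≤1+n; n≤0⇒n≡0; n≢0⇒n>0; <-irrefl; ≰⇒>;
         _≤?_; +-identityʳ; +-suc)
  renaming (_≟_ to _≟ℕ_)
open import Data.Product using (_×_; _,_; proj₁; proj₂; ∃-syntax; swap)
open import Data.Sum using (_⊎_; inj₁; inj₂; [_,_])
open import Data.Vec using (_∷_; []; lookup)
open import Data.Vec.Relation.Unary.All using (_∷_; [])
open import Data.Vec.Relation.Unary.AllPairs using (_∷_; [])
open import Data.Vec.Relation.Unary.Unique.Propositional.Properties using (lookup-injective)
open import Function using (_∘_)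
open import Function.Bundles using (Equivalence)
open import Relation.Binary.Construct.Closure.ReflexiveTransitive
  using (Star; ε; _◅_; _◅◅_; reverse; concat; foldl)
open import Relation.Binary.PropositionalEquality
  using (_≡_; _≢_; refl; sym; trans; cong; cong₂; subst; ≢-sym)
open import Relation.Nullary using (¬_; Dec; yes; no; contradiction)
open import Relation.Nullary.Decidable using (dec-true)

Bounded : ℕ × ℕ → Set
Bounded h = h ≡ (0 , 0) ⊎ h ≡ (1 , 1) ⊎ h ≡ (1 , 2) ⊎ h ≡ (2 , 1) ⊎ h ≡ (2 , 2)

module _ {A : Set} where

  ∈⇒length≢0 : {x : A} {xs : List A} → x ∈ xs → length xs ≢ 0
  ∈⇒length≢0 (here _)  ()
  ∈⇒length≢0 (there _) ()

  length≢0⇒∈ : {xs : List A} → length xs ≢ 0 → ∃[ x ] x ∈ xs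
  length≢0⇒∈ {[]}     0≢0 = contradiction refl 0≢0
  length≢0⇒∈ {x ∷ xs} _   = x , here refl

  module _ {P : Pred A 0ℓ} (P? : Decidable P) where

    filter-nonempty⇒∃ : (xs : List A) → length (filter P? xs) ≢ 0 → ∃[ x ] P x
    filter-nonempty⇒∃ xs nonempty with length≢0⇒∈ {filter P? xs} nonempty
    ... | x , x∈ = x , proj₂ (∈-filter⁻ P? {xs = xs} x∈)

    ∈⇒filter-nonempty : {x : A} {xs : List A} → x ∈ xs → P x →
                        length (filter P? xs) ≢ 0
    ∈⇒filter-nonempty x∈ px = ∈⇒length≢0 (∈-filter⁺ P? x∈ px)

Fin≤2-cover : ∀ {m} → m ≤ 2 → (x y z : Fin m) → x ≢ y → z ≡ x ⊎ z ≡ y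
Fin≤2-cover (s≤s z≤n)       zero       zero       _          x≢y = contradiction refl x≢y
Fin≤2-cover (s≤s (s≤s z≤n)) zero       zero       _          x≢y = contradiction refl x≢y
Fin≤2-cover (s≤s (s≤s z≤n)) (suc zero) (suc zero) _          x≢y = contradiction refl x≢y
Fin≤2-cover (s≤s (s≤s z≤n)) zero       (suc zero) zero       _   = inj₁ refl
Fin≤2-cover (s≤s (s≤s z≤n)) zero       (suc zero) (suc zero) _   = inj₂ refl
Fin≤2-cover (s≤s (s≤s z≤n)) (suc zero) zero       zero       _   = inj₂ refl
Fin≤2-cover (s≤s (s≤s z≤n)) (suc zero) zero       (suc zero) _   = inj₁ refl

module Walks (G : Digraph) where
  open Digraph G using (n; irrefl)

  infix 4 _⟶_
  _⟶_ : V G → V G → Set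
  _⟶_ = Arc G

  private
    variable
      x y z : V G
      k : ℕ

  arc⇒≢ : x ⟶ y → x ≢ y
  arc⇒≢ {x} x⟶x refl with () ← trans (sym x⟶x) (irrefl x)

  walk-zero : walkB G 0 x x ≡ true
  walk-zero {x} = dec-true (x ≟ x) refl

  walk-zero⁻ : walkB G 0 x y ≡ true → x ≡ y
  walk-zero⁻ {x} {y} w with x ≟ y
  ... | yes x≡y = x≡y
  ... | no _ with () ← w

  walk-suc : x ⟶ z → walkB G k z y ≡ true → walkB G (suc k) x y ≡ true
  walk-suc {x} {z} {k} {y} x⟶z w = Equivalence.to T-≡ (any⁺ _ (lose (∈-allFin z) step))
    where
    step : T (Digraph.arc G x z ∧ walkB G k z y)
    step = Equivalence.from T-∧ (Equivalence.from T-≡ x⟶z , Equivalence.from T-≡ w)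

  walk-suc⁻ : walkB G (suc k) x y ≡ true → ∃[ z ] (x ⟶ z × walkB G k z y ≡ true)
  walk-suc⁻ w with satisfied (any⁻ _ (allFin n) (Equivalence.from T-≡ w))
  ... | z , step with Equivalence.to T-∧ step
  ...   | x⟶z , rest = z , Equivalence.to T-≡ x⟶z , Equivalence.to T-≡ rest

  walk-one : x ⟶ y → walkB G 1 x y ≡ true
  walk-one {x} {y} x⟶y = walk-suc {k = 0} {y = y} x⟶y (walk-zero {y})

  walk-one⁻ : walkB G 1 x y ≡ true → x ⟶ y
  walk-one⁻ {x} {y} w with walk-suc⁻ {0} {x} {y} w
  ... | z , x⟶z , w₀ = subst (x ⟶_) (walk-zero⁻ {z} {y} w₀) x⟶z

  search-≤ : ∀ fuel {j} → j ≤ k → walkB G k x y ≡ true → search G fuel j x y ≤ k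
  search-≤ zero       j≤k _ = j≤k
  search-≤ {k} {x} {y} (suc fuel) {j} j≤k w with walkB G j x y in wj
  ... | true  = j≤k
  ... | false = search-≤ fuel (≤∧≢⇒< j≤k j≢k) w
    where
    j≢k : j ≢ k
    j≢k refl with () ← trans (sym wj) w

  search-spec : ∀ fuel j → walkB G (search G fuel j x y) x y ≡ true
                         ⊎ search G fuel j x y ≡ j + fuel
  search-spec zero       j = inj₂ (sym (+-identityʳ j))
  search-spec {x} {y} (suc fuel) j with walkB G j x y in wj
  ... | true  = inj₁ wj
  ... | false with search-spec fuel (suc j)
  ...   | inj₁ w = inj₁ w
  ...   | inj₂ e = inj₂ (trans e (sym (+-suc j fuel)))

  dist-≤ : walkB G k x y ≡ true → dist G x y ≤ k
  dist-≤ = search-≤ n z≤n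

  dist≡⇒walk : dist G x y ≡ k → k < n → walkB G k x y ≡ true
  dist≡⇒walk {x} {y} refl k<n with search-spec {x} {y} n 0
  ... | inj₁ w   = w
  ... | inj₂ k≡n = contradiction k<n (<-irrefl k≡n)

  dist-self : dist G x x ≡ 0
  dist-self {x} = n≤0⇒n≡0 (dist-≤ {0} {x} {x} (walk-zero {x}))

  dist≢0 : x ≢ y → dist G x y ≢ 0
  dist≢0 {x} x≢y d≡0 = x≢y (walk-zero⁻ (dist≡⇒walk d≡0 (>-nonZero⁻¹ n {{nonZeroIndex x}})))

  arc⇒dist≡1 : x ⟶ y → dist G x y ≡ 1
  arc⇒dist≡1 x⟶y = ≤-antisym (dist-≤ (walk-one x⟶y)) (n≢0⇒n>0 (dist≢0 (arc⇒≢ x⟶y)))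

  arc⇒dist≢2 : x ⟶ y → dist G x y ≢ 2
  arc⇒dist≢2 x⟶y d≡2 = contradiction (trans (sym (arc⇒dist≡1 x⟶y)) d≡2) λ ()

  walk⇒arc-if-n≤2 : n ≤ 2 → x ≢ y → walkB G k x y ≡ true → x ⟶ y
  walk⇒arc-if-n≤2 {k = zero}  _   x≢y w = contradiction (walk-zero⁻ w) x≢y
  walk⇒arc-if-n≤2 {x} {y} {k = suc k} n≤2 x≢y w with walk-suc⁻ {k} {x} {y} w
  ... | z , x⟶z , rest with Fin≤2-cover n≤2 x y z x≢y
  ...   | inj₁ refl = walk⇒arc-if-n≤2 {x} {y} {k} n≤2 x≢y rest
  ...   | inj₂ refl = x⟶z

  dist≡2⇒2<n : StronglyConnected G → dist G x y ≡ 2 → 2 < n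
  dist≡2⇒2<n {x} {y} connected d≡2 with n ≤? 2
  ... | no n≰2  = ≰⇒> n≰2
  ... | yes n≤2 = ⊥-elim (arc⇒dist≢2 y-reached-directly d≡2)
    where
    x≢y : x ≢ y
    x≢y refl = contradiction (trans (sym d≡2) dist-self) λ ()
    y-reached-directly : x ⟶ y
    y-reached-directly with connected x y
    ... | k , walk = walk⇒arc-if-n≤2 {x} {y} {k} n≤2 x≢y walk

module IntersectionNumbers (G : Digraph) where
  open Digraph G using (n)

  private
    variable
      x y z : V G

  pcount≢0⇒∃ : ∀ {i j} → pcount G x y i j ≢ 0 →
               ∃[ z ] (dist2 G x z ≡ i × dist2 G z y ≡ j)
  pcount≢0⇒∃ = filter-nonempty⇒∃ _ (allFin n)

  ∃⇒pcount≢0 : ∀ {i j} → dist2 G x z ≡ i → dist2 G z y ≡ j → pcount G x y i j ≢ 0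
  ∃⇒pcount≢0 {z = z} xz zy = ∈⇒filter-nonempty _ (∈-allFin z) (xz , zy)

module Circuits (G : Digraph) where
  open Walks G

  circuit₃ : ∀ {a b c} → a ⟶ b → b ⟶ c → c ⟶ a →
             IsCircuit G 2 (lookup (a ∷ b ∷ c ∷ []))
  circuit₃ ab bc ca =
    lookup-injective ((arc⇒≢ ab ∷ ≢-sym (arc⇒≢ ca) ∷ []) ∷ (arc⇒≢ bc ∷ []) ∷ [] ∷ []) ,
    (λ { zero → ab ; (suc zero) → bc }) , ca

  circuit₄ : ∀ {a b c e} → a ⟶ b → b ⟶ c → c ⟶ e → e ⟶ a →
             a ≢ c → b ≢ e →
             IsCircuit G 3 (lookup (a ∷ b ∷ c ∷ e ∷ []))
  circuit₄ ab bc ce ea a≢c b≢e =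
    lookup-injective ( (arc⇒≢ ab ∷ a≢c ∷ ≢-sym (arc⇒≢ ea) ∷ [])
                     ∷ (arc⇒≢ bc ∷ b≢e ∷ []) ∷ (arc⇒≢ ce ∷ []) ∷ [] ∷ []) ,
    (λ { zero → ab ; (suc zero) → bc ; (suc (suc zero)) → ce }) , ea

-- With at most two vertices, `dist` may return its fallback value n ≤ 2 even
-- when no walk of that length exists.
module SmallDistance (G : Digraph) (2<n : 2 < Digraph.n G) where
  open Walks G

  private
    variable
      x y : V G

  Near : V G → V G → Set
  Near x y = x ⟶ y ⊎ ∃[ m ] (x ⟶ m × m ⟶ y)

  near⇒dist≤2 : Near x y → dist G x y ≤ 2
  near⇒dist≤2 {x} {y} (inj₁ x⟶y) = m≤n⇒m≤1+n (dist-≤ {1} {x} {y} (walk-one x⟶y))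
  near⇒dist≤2 {x} {y} (inj₂ (m , x⟶m , m⟶y)) =
    dist-≤ {2} {x} {y} (walk-suc {k = 1} {y = y} x⟶m (walk-one m⟶y))

  dist≡1⇒arc : dist G x y ≡ 1 → x ⟶ y
  dist≡1⇒arc d≡1 = walk-one⁻ (dist≡⇒walk d≡1 (≤-<-trans (s≤s z≤n) 2<n))

  dist≡2⇒path : dist G x y ≡ 2 → ∃[ m ] (x ⟶ m × m ⟶ y)
  dist≡2⇒path {x} {y} d≡2 with walk-suc⁻ {1} {x} {y} (dist≡⇒walk d≡2 2<n)
  ... | m , x⟶m , m⟶y = m , x⟶m , walk-one⁻ m⟶y

  dist≤2⇒near : x ≢ y → dist G x y ≤ 2 → Near x y
  dist≤2⇒near {x} {y} x≢y d≤2 with dist G x y in d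
  ... | 0     = contradiction d (dist≢0 x≢y)
  ... | 1     = inj₁ (dist≡1⇒arc d)
  ... | 2     = inj₂ (dist≡2⇒path d)
  ... | suc (suc (suc _)) with s≤s (s≤s ()) ← d≤2

  2≤dist : x ≢ y → ¬ x ⟶ y → 2 ≤ dist G x y
  2≤dist {x} {y} x≢y ¬x⟶y with dist G x y in d
  ... | 0           = contradiction d (dist≢0 x≢y)
  ... | 1           = contradiction (dist≡1⇒arc d) ¬x⟶y
  ... | suc (suc _) = s≤s (s≤s z≤n)

  near⇒dist≡2 : x ≢ y → ¬ x ⟶ y → Near x y → dist G x y ≡ 2
  near⇒dist≡2 x≢y ¬x⟶y near = ≤-antisym (near⇒dist≤2 near) (2≤dist x≢y ¬x⟶y)

module Type₁₂ (G : Digraph) (2<n : 2 < Digraph.n G) (semicomplete : LocallySemicomplete G)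
              (pure₁₂ : Pure G 2) (4∉T⊎pure₁₃ : ¬ InT-pred G 3 ⊎ Pure G 3) where
  open Walks G
  open Circuits G
  open IntersectionNumbers G
  open SmallDistance G 2<n

  private
    variable
      a b c e u v x y z m w : V G

  Arc₁₂ : V G → V G → Set
  Arc₁₂ = HasType G 2

  arc? : (x y : V G) → Dec (x ⟶ y)
  arc? x y = Digraph.arc G x y Bool.≟ true

  out-adjacent : v ⟶ a → v ⟶ b → a ≢ b → a ⟶ b ⊎ b ⟶ a
  out-adjacent = proj₁ semicomplete _ _ _

  in-adjacent : a ⟶ v → b ⟶ v → a ≢ b → a ⟶ b ⊎ b ⟶ a
  in-adjacent = proj₂ semicomplete _ _ _

  arc₁₂-asym : Arc₁₂ x y → ¬ y ⟶ x
  arc₁₂-asym (_ , d≡2) y⟶x = arc⇒dist≢2 y⟶x d≡2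

  mk-arc₁₂ : x ⟶ y → ¬ y ⟶ x → Near y x → Arc₁₂ x y
  mk-arc₁₂ x⟶y ¬y⟶x near = x⟶y , near⇒dist≡2 (≢-sym (arc⇒≢ x⟶y)) ¬y⟶x near

  arc₁₂-dist2 : Arc₁₂ x y → dist2 G x y ≡ (1 , 2)
  arc₁₂-dist2 (x⟶y , d≡2) = cong₂ _,_ (arc⇒dist≡1 x⟶y) d≡2

  triangle : Arc₁₂ x y → ∃[ w ] (Arc₁₂ y w × Arc₁₂ w x)
  triangle {x} {y} xy@(x⟶y , d≡2) with dist≡2⇒path d≡2
  ... | w , y⟶w , w⟶x =
    w , on-circuit (inj₁ (suc zero , refl , refl)) , on-circuit (inj₂ (refl , refl))
    where
    on-circuit : CircuitArc G 2 (lookup (x ∷ y ∷ w ∷ [])) u v → Arc₁₂ u v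
    on-circuit {u} {v} =
      pure₁₂ _ (circuit₃ x⟶y y⟶w w⟶x) (x , y , inj₁ (zero , refl , refl) , xy) u v

  arc₁₃-excludes-arc₁₂ : ∀ {γ} → IsCircuit G 3 γ →
                         CircuitArc G 3 γ x y → HasType G 3 x y →
                         CircuitArc G 3 γ u v → ¬ Arc₁₂ u v
  arc₁₃-excludes-arc₁₂ {x} {y} circuit xy xy₁₃ uv (_ , d≡2) = excluded 4∉T⊎pure₁₃
    where
    excluded : ¬ InT-pred G 3 ⊎ Pure G 3 → ⊥
    excluded (inj₁ 4∉T)    = 4∉T (x , y , cong₂ _,_ (arc⇒dist≡1 (proj₁ xy₁₃)) (proj₂ xy₁₃))
    excluded (inj₂ pure₁₃) =
      contradiction (trans (sym d≡2) (proj₂ (pure₁₃ _ circuit (x , y , xy , xy₁₃) _ _ uv))) λ ()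

  -- Along the circuit ∂(b,a) ≤ 3, and ∂(b,a) = 3 would put an arc of type (1,3)
  -- on a 4-circuit together with a (1,2)-arc.
  near-back-on-circuit₄ : a ⟶ b → b ⟶ c → c ⟶ e → e ⟶ a →
                          Arc₁₂ b c ⊎ Arc₁₂ c e ⊎ Arc₁₂ e a → Near b a
  near-back-on-circuit₄ {a} {b} {c} {e} ab bc ce ea red with b ≟ e | c ≟ a
  ... | yes refl | _        = inj₁ ea
  ... | no _     | yes refl = inj₁ bc
  ... | no b≢e   | no c≢a   with dist G b a ≟ℕ 3
  ...   | no d≢3 =
    dist≤2⇒near (≢-sym (arc⇒≢ ab)) (≤-pred (≤∧≢⇒< (dist-≤ {3} {b} {a} walk₃) d≢3))
    where
    walk₃ : walkB G 3 b a ≡ true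
    walk₃ = walk-suc {k = 2} {y = a} bc (walk-suc {k = 1} {y = a} ce (walk-one ea))
  ...   | yes d≡3 = ⊥-elim ([ excluded (inj₁ (suc zero , refl , refl))
                           , [ excluded (inj₁ (suc (suc zero) , refl , refl))
                             , excluded (inj₂ (refl , refl)) ] ] red)
    where
    excluded : CircuitArc G 3 (lookup (a ∷ b ∷ c ∷ e ∷ [])) u v → ¬ Arc₁₂ u v
    excluded = arc₁₃-excludes-arc₁₂ (circuit₄ ab bc ce ea (≢-sym c≢a) b≢e)
                                    (inj₁ (zero , refl , refl)) (ab , d≡3)

  path₁₂-≢ : Arc₁₂ x m → Arc₁₂ m y → x ≢ y
  path₁₂-≢ xm my refl = arc₁₂-asym xm (proj₁ my)

  through-triangle : ¬ x ⟶ y → ¬ y ⟶ x → Arc₁₂ x m → Arc₁₂ m y →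
                     ∃[ w ] (Arc₁₂ m w × Arc₁₂ w x × y ⟶ w)
  through-triangle {x} {y} ¬xy ¬yx xm my with triangle xm
  ... | w , mw , wx = w , mw , wx , y⟶w
    where
    y⟶w : y ⟶ w
    y⟶w with y ≟ w
    ... | yes refl = contradiction (proj₁ wx) ¬yx
    ... | no y≢w with out-adjacent (proj₁ my) (proj₁ mw) y≢w
    ...   | inj₁ yw = yw
    ...   | inj₂ wy = ⊥-elim ([ ¬xy , ¬yx ] (out-adjacent (proj₁ wx) wy (path₁₂-≢ xm my)))

  path₁₂-dist2 : ¬ x ⟶ y → ¬ y ⟶ x → Arc₁₂ x m → Arc₁₂ m y →
                 dist2 G x y ≡ (2 , 2)
  path₁₂-dist2 {x} {y} ¬xy ¬yx xm my with through-triangle ¬xy ¬yx xm my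
  ... | w , _ , wx , yw = cong₂ _,_
    (near⇒dist≡2 x≢y ¬xy (inj₂ (_ , proj₁ xm , proj₁ my)))
    (near⇒dist≡2 (≢-sym x≢y) ¬yx (inj₂ (w , yw , proj₁ wx)))
    where
    x≢y : x ≢ y
    x≢y = path₁₂-≢ xm my

  near-back : Arc₁₂ y z → y ⟶ w → Arc₁₂ w x → x ⟶ z → Near z x
  near-back {y} {z} {w} {x} yz yw wx xz with z ≟ w | triangle yz
  ... | yes refl | _ = inj₁ (proj₁ wx)
  ... | no z≢w | u , zu , uy with out-adjacent (proj₁ yz) yw z≢w
  ...   | inj₁ zw = inj₂ (w , zw , proj₁ wx)
  ...   | inj₂ wz with near-back-on-circuit₄ wz (proj₁ zu) (proj₁ uy) yw (inj₁ zu)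
  ...     | inj₁ zw            = inj₂ (w , zw , proj₁ wx)
  ...     | inj₂ (v , zv , vw) = near-back-on-circuit₄ xz zv vw (proj₁ wx) (inj₂ (inj₂ wx))

  data Admissible (x : V G) : V G → Set where
    diagonal  : Admissible x x
    symmetric : x ⟶ y → y ⟶ x → Admissible x y
    forward   : Arc₁₂ x y → Admissible x y
    backward  : Arc₁₂ y x → Admissible x y
    through   : ¬ x ⟶ y → ¬ y ⟶ x → Arc₁₂ x m → Arc₁₂ m y → Admissible x y

  admissible-from : (x ⟶ z → Near z x) → (z ⟶ x → Near x z) →
                    (¬ x ⟶ z → ¬ z ⟶ x → ∃[ m ] (Arc₁₂ x m × Arc₁₂ m z)) →
                    Admissible x z
  admissible-from {x} {z} near-zx near-xz path with arc? x z | arc? z x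
  ... | yes xz  | yes zx  = symmetric xz zx
  ... | yes xz  | no ¬zx  = forward (mk-arc₁₂ xz ¬zx (near-zx xz))
  ... | no ¬xz  | yes zx  = backward (mk-arc₁₂ zx ¬xz (near-xz zx))
  ... | no ¬xz  | no ¬zx  with path ¬xz ¬zx
  ...   | m , xm , mz = through ¬xz ¬zx xm mz

  step-symmetric : x ⟶ y → y ⟶ x → Arc₁₂ y z → Admissible x z
  step-symmetric {x} {y} {z} xy yx yz with x ≟ z | triangle yz
  ... | yes refl | _ = contradiction xy (arc₁₂-asym yz)
  ... | no x≢z | u , zu , uy = admissible-from
    (λ xz → near-back-on-circuit₄ xz (proj₁ zu) (proj₁ uy) yx (inj₁ zu))
    (λ _ → inj₂ (y , xy , proj₁ yz))
    (λ ¬xz ¬zx → ⊥-elim ([ ¬xz , ¬zx ] (out-adjacent yx (proj₁ yz) x≢z)))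

  step-forward : Arc₁₂ x y → Arc₁₂ y z → Admissible x z
  step-forward {x} {y} xy yz with triangle xy
  ... | w , yw , wx = admissible-from
    (near-back yz (proj₁ yw) wx)
    (λ _ → inj₂ (y , proj₁ xy , proj₁ yz))
    (λ _ _ → y , xy , yz)

  step-backward : Arc₁₂ y x → Arc₁₂ y z → Admissible x z
  step-backward {y} {x} {z} yx yz with x ≟ z | triangle yx | triangle yz
  ... | yes refl | _ | _ = diagonal
  ... | no x≢z | w , xw , wy | u , zu , uy = admissible-from
    (λ xz → near-back-on-circuit₄ xz (proj₁ zu) (proj₁ uy) (proj₁ yx) (inj₁ zu))
    (λ zx → near-back-on-circuit₄ zx (proj₁ xw) (proj₁ wy) (proj₁ yz) (inj₁ xw))
    (λ ¬xz ¬zx → ⊥-elim ([ ¬xz , ¬zx ] (out-adjacent (proj₁ yx) (proj₁ yz) x≢z)))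

  step-through : ¬ x ⟶ y → ¬ y ⟶ x → Arc₁₂ x m → Arc₁₂ m y → Arc₁₂ y z →
                 Admissible x z
  step-through {x} {y} {m} {z} ¬xy ¬yx xm my yz with through-triangle ¬xy ¬yx xm my
  ... | w , mw , wx , yw = admissible-from
    (near-back yz yw wx)
    (λ zx → near-back-on-circuit₄ zx (proj₁ xm) (proj₁ my) (proj₁ yz) (inj₁ xm))
    (λ ¬xz ¬zx → m , xm , m⟶₁₂z ¬xz ¬zx)
    where
    x≢z : x ≢ z
    x≢z refl = ¬yx (proj₁ yz)
    m≢z : m ≢ z
    m≢z refl = arc₁₂-asym my (proj₁ yz)
    m⟶₁₂z : ¬ x ⟶ z → ¬ z ⟶ x → Arc₁₂ m z
    m⟶₁₂z ¬xz ¬zx with z ≟ w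
    ... | yes refl = contradiction (proj₁ wx) ¬zx
    ... | no z≢w with out-adjacent (proj₁ yz) yw z≢w
    ...   | inj₂ wz = ⊥-elim ([ ¬xz , ¬zx ] (out-adjacent (proj₁ wx) wz x≢z))
    ...   | inj₁ zw with in-adjacent (proj₁ mw) zw m≢z
    ...     | inj₂ zm = ⊥-elim ([ ¬xz , ¬zx ] (in-adjacent (proj₁ xm) zm x≢z))
    ...     | inj₁ mz = mk-arc₁₂ mz
      (λ zm → [ ¬xz , ¬zx ] (in-adjacent (proj₁ xm) zm x≢z))
      (near-back-on-circuit₄ mz zw (proj₁ wx) (proj₁ xm) (inj₂ (inj₁ wx)))

  step : Admissible x y → Arc₁₂ y z → Admissible x z
  step diagonal                  = forward
  step (symmetric xy yx)         = step-symmetric xy yx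
  step (forward xy)              = step-forward xy
  step (backward yx)             = step-backward yx
  step (through ¬xy ¬yx xm my)   = step-through ¬xy ¬yx xm my

  admissible-bounded : Admissible x y → Bounded (dist2 G x y)
  admissible-bounded {x} diagonal rewrite dist-self {x} = inj₁ refl
  admissible-bounded (symmetric xy yx)
    rewrite arc⇒dist≡1 xy | arc⇒dist≡1 yx = inj₂ (inj₁ refl)
  admissible-bounded (forward xy)
    rewrite arc₁₂-dist2 xy = inj₂ (inj₂ (inj₁ refl))
  admissible-bounded (backward (yx , d≡2))
    rewrite arc⇒dist≡1 yx | d≡2 = inj₂ (inj₂ (inj₂ (inj₁ refl)))
  admissible-bounded (through ¬xy ¬yx xm my)
    rewrite path₁₂-dist2 ¬xy ¬yx xm my = inj₂ (inj₂ (inj₂ (inj₂ refl)))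

  admissible-22⇒path₁₂ : Admissible x y → dist G x y ≡ 2 → dist G y x ≡ 2 →
                         ∃[ m ] (Arc₁₂ x m × Arc₁₂ m y)
  admissible-22⇒path₁₂ {x} diagonal      d≡2 _   = contradiction (trans (sym (dist-self {x})) d≡2) λ ()
  admissible-22⇒path₁₂ (symmetric xy _)    d≡2 _   = ⊥-elim (arc⇒dist≢2 xy d≡2)
  admissible-22⇒path₁₂ (forward (xy , _))  d≡2 _   = ⊥-elim (arc⇒dist≢2 xy d≡2)
  admissible-22⇒path₁₂ (backward (yx , _)) _   d≡2 = ⊥-elim (arc⇒dist≢2 yx d≡2)
  admissible-22⇒path₁₂ (through _ _ xm my) _   _   = _ , xm , my

  Connected : V G → V G → Set
  Connected = Star Arc₁₂

  admissible : Connected x y → Admissible x y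
  admissible = foldl Admissible step diagonal

  connected-sym : Connected x y → Connected y x
  connected-sym = concat ∘ reverse around-triangle
    where
    around-triangle : Arc₁₂ x y → Connected y x
    around-triangle xy with triangle xy
    ... | _ , yw , wx = yw ◅ wx ◅ ε

  ConnectedClass : ℕ × ℕ → Set
  ConnectedClass h = InValues G h × (∀ {x y} → dist2 G x y ≡ h → Connected x y)

  connectedClass-closed : WeaklyDistanceRegular G → Closed G ConnectedClass
  connectedClass-closed (_ , regular) i j h (_ , i-connected) (_ , j-connected)
                        (x₀ , y₀ , x₀y₀ , p≢0) = (x₀ , y₀ , x₀y₀) , h-connected
    where
    h-connected : dist2 G x y ≡ h → Connected x y
    h-connected {x} {y} xy
      with pcount≢0⇒∃ (p≢0 ∘ trans (regular x₀ y₀ x y (swap i) j (trans x₀y₀ (sym xy))))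
    ... | z , xz , zy = connected-sym (i-connected (cong swap xz)) ◅◅ j-connected zy

  Γ₁₂-connected : InT-pred G 2 → ConnectedClass (1 , 2)
  Γ₁₂-connected 3∈T = 3∈T , λ xy → (dist≡1⇒arc (cong proj₁ xy) , cong proj₂ xy) ◅ ε

  F₃⊆ConnectedClass : WeaklyDistanceRegular G → InT-pred G 2 →
                      ∀ {h} → InF3 G h → ConnectedClass h
  F₃⊆ConnectedClass wdr 3∈T h∈F₃ =
    h∈F₃ ConnectedClass (λ _ → proj₁) (connectedClass-closed wdr) (Γ₁₂-connected 3∈T)

lemma5p1 : (G : Digraph) → LocallySemicomplete G → Commutative G →
    WeaklyDistanceRegular G → InT-pred G 2 → Pure G 2 →
    (¬ InT-pred G 3 ⊎ Pure G 3) →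
    ((∀ h → InF3 G h →
        (h ≡ (0 , 0)) ⊎ (h ≡ (1 , 1)) ⊎ (h ≡ (1 , 2)) ⊎ (h ≡ (2 , 1)) ⊎ (h ≡ (2 , 2)))
     × (InF3 G (2 , 2) → Prod G (1 , 2) (1 , 2) (2 , 2)))
lemma5p1 G semicomplete _ wdr@(connected , _) 3∈T@(_ , _ , xy₁₂) pure₁₂ 4∉T⊎pure₁₃ =
  bounded , Γ₂₂∈Γ₁₂²
  where
  open Type₁₂ G (Walks.dist≡2⇒2<n G connected (cong proj₂ xy₁₂)) semicomplete pure₁₂ 4∉T⊎pure₁₃
  open IntersectionNumbers G

  bounded : ∀ h → InF3 G h → Bounded h
  bounded h h∈F₃ with F₃⊆ConnectedClass wdr 3∈T h∈F₃
  ... | (x , y , refl) , h-connected = admissible-bounded (admissible (h-connected refl))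

  Γ₂₂∈Γ₁₂² : InF3 G (2 , 2) → Prod G (1 , 2) (1 , 2) (2 , 2)
  Γ₂₂∈Γ₁₂² h∈F₃ with F₃⊆ConnectedClass wdr 3∈T h∈F₃
  ... | (x , y , xy) , h-connected
    with admissible-22⇒path₁₂ (admissible (h-connected xy)) (cong proj₁ xy) (cong proj₂ xy)
  ...   | m , xm , my = x , y , xy , ∃⇒pcount≢0 (arc₁₂-dist2 xm) (arc₁₂-dist2 my)
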